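{- Let $b \geqslant 2$ be an integer and let $G$ be a graph with $\delta(G) > (1 - 1/b)|G|$. If $C$ is an induced $4$-cycle in $G$ and $G_C$ contains a clique on $b-2$ vertices, then at least one of the two non-adjacent pairs of vertices of $C$ is $b$-dense.
   Context: Graphs are finite and simple; $|G|$ is the number of vertices, $\delta(G)$ the minimum degree. For a set $X$ of vertices, $G_X$ is the subgraph induced on the common neighbourhood of all vertices of $X$ (here $X = V(C)$). A pair of vertices $u,v$ is $b$-dense if the subgraph induced on their common neighbourhood contains a clique on $b$ vertices. (A clique on $0$ vertices is always present.) -}

module Defs where

open import Data.Nat using (ℕ; _*_; _∸_; _<_)
open import Data.Fin using (Fin)
open import Data.Bool using (Bool; true; false)
open import Data.List using (List; length; filter)
open import Data.List using () renaming (allFin to allFinL)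
open import Data.Product using (Σ; _×_)
open import Relation.Binary.PropositionalEquality using (_≡_)
open import Relation.Nullary using (¬_)
open import Function.Definitions using (Injective)
open import Data.Bool.Properties using (T?)
open import Data.Bool using (T)

record Graph (n : ℕ) : Set where
  field
    adj   : Fin n → Fin n → Bool
    sym   : ∀ u v → adj u v ≡ adj v u
    irrefl : ∀ v → adj v v ≡ false

open Graph public

Adj : ∀ {n} → Graph n → Fin n → Fin n → Set
Adj G u v = T (adj G u v)

degree : ∀ {n} → Graph n → Fin n → ℕ
degree {n} G v = length (filter (λ u → T? (adj G v u)) (allFinL n))

HasCliqueIn : ∀ {n} → Graph n → (Fin n → Set) → ℕ → Set
HasCliqueIn {n} G P k =
  Σ (Fin k → Fin n) λ f →
    Injective _≡_ _≡_ f ×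
    (∀ i → P (f i)) ×
    (∀ i j → ¬ i ≡ j → Adj G (f i) (f j))

Dense : ∀ {n} → Graph n → ℕ → Fin n → Fin n → Set
Dense G b u v = HasCliqueIn G (λ x → Adj G u x × Adj G v x) b

InducedC4 : ∀ {n} → Graph n → Fin n → Fin n → Fin n → Fin n → Set
InducedC4 G c₀ c₁ c₂ c₃ =
  ¬ c₀ ≡ c₁ × ¬ c₀ ≡ c₂ × ¬ c₀ ≡ c₃ × ¬ c₁ ≡ c₂ × ¬ c₁ ≡ c₃ × ¬ c₂ ≡ c₃ ×
  Adj G c₀ c₁ × Adj G c₁ c₂ × Adj G c₂ c₃ × Adj G c₃ c₀ ×
  ¬ Adj G c₀ c₂ × ¬ Adj G c₁ c₃

-- Common neighbourhood of the four vertices of C (the vertex set of G_C).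
CommonNbr4 : ∀ {n} → Graph n → Fin n → Fin n → Fin n → Fin n → Fin n → Set
CommonNbr4 G c₀ c₁ c₂ c₃ x =
  Adj G c₀ x × Adj G c₁ x × Adj G c₂ x × Adj G c₃ x

-- δ(G) > (1 - 1/b)|G|, cleared of denominators (b ≥ 1):
-- for every vertex v, (b - 1)·n < b · deg(v).
MinDegAbove : ∀ {n} → Graph n → ℕ → Set
MinDegAbove {n} G b = ∀ v → (b ∸ 1) * n < b * degree G v

-- Count each vertex of C once and each vertex of the clique K ⊆ G_C twice: a
-- list of 4 + 2(b - 2) = 2b vertices.  Since every degree exceeds (1 - 1/b)|G|,
-- double counting gives a vertex x adjacent to more than 2(b - 1) entries of this
-- list, which forces x to be adjacent to all of K and to three vertices of C.  So
-- x sees both ends p, q of a non-adjacent pair of C and the vertex u of C between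
-- them, and K together with u and x is a b-clique in the common neighbourhood of
-- p and q.
module Submission where

open import Defs
open import Data.Nat using (ℕ; _≤_; _∸_)
open import Data.Fin using (Fin)
open import Data.Sum using (_⊎_)

open import Algebra.Properties.CommutativeSemigroup using (interchange)
open import Data.Bool using (Bool; true; false; T)
open import Data.Bool.Properties using (T?)
open import Data.Fin using (zero; suc)
open import Data.List using (List; []; _∷_; _++_; length; map; filter; tabulate)
open import Data.List using () renaming (allFin to allFinL)
open import Data.List.Properties using (map-++; map-cong; length-++; length-tabulate)
open import Data.List.Relation.Unary.All as All using (All; _∷_)
open import Data.List.Relation.Unary.All.Properties using (¬Any⇒All¬; tabulate⁻)
open import Data.List.Relation.Unary.Any using (Any; any?; satisfied)
open import Data.Nat using (zero; suc; _+_; _*_; _<_; _<?_; z≤n; s≤s; s≤s⁻¹; NonZero; >-nonZero⁻¹)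
open import Data.Nat.ListAction using (sum)
open import Data.Nat.ListAction.Properties using (sum-++)
open import Data.Nat.Properties
open import Data.Nat.Tactic.RingSolver using (solve-∀)
open import Data.Product using (∃; _×_; _,_; proj₁; proj₂; map₂)
open import Data.Sum using (inj₁; inj₂)
open import Data.Unit using (tt)
open import Data.Vec.Functional using () renaming (_∷_ to _◂_)
open import Function using (_∘_; id)
open import Relation.Nullary using (yes; no; contradiction)
open import Relation.Binary.PropositionalEquality
  using (_≡_; _≢_; refl; cong; cong₂; subst; subst₂; trans)
  renaming (sym to ≡-sym)

module _ {A : Set} where

  sum-map-+ : (xs : List A) (f g : A → ℕ) →
              sum (map (λ x → f x + g x) xs) ≡ sum (map f xs) + sum (map g xs)
  sum-map-+ []       f g = refl
  sum-map-+ (x ∷ xs) f g rewrite sum-map-+ xs f g =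
    interchange +-commutativeSemigroup (f x) (g x) (sum (map f xs)) (sum (map g xs))

  sum-map-*ˡ : (k : ℕ) (xs : List A) (f : A → ℕ) →
               sum (map (λ x → k * f x) xs) ≡ k * sum (map f xs)
  sum-map-*ˡ k []       f = ≡-sym (*-zeroʳ k)
  sum-map-*ˡ k (x ∷ xs) f rewrite sum-map-*ˡ k xs f = ≡-sym (*-distribˡ-+ k (f x) _)

  sum-map-≥ : ∀ {c} (xs : List A) (f : A → ℕ) → (∀ x → c ≤ f x) →
              length xs * c ≤ sum (map f xs)
  sum-map-≥ []       f c≤f = z≤n
  sum-map-≥ (x ∷ xs) f c≤f = +-mono-≤ (c≤f x) (sum-map-≥ xs f c≤f)

  sum-map-≤ : ∀ {c} (xs : List A) (f : A → ℕ) → All (λ x → f x ≤ c) xs →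
              sum (map f xs) ≤ length xs * c
  sum-map-≤ []       f All.[]       = z≤n
  sum-map-≤ (x ∷ xs) f (fx≤c ∷ f≤c) = +-mono-≤ fx≤c (sum-map-≤ xs f f≤c)

  pigeonhole : ∀ {c} (xs : List A) (f : A → ℕ) →
               length xs * c < sum (map f xs) → Any (λ x → c < f x) xs
  pigeonhole {c} xs f total with any? (λ x → c <? f x) xs
  ... | yes some = some
  ... | no  none = contradiction
    (sum-map-≤ xs f (All.map ≮⇒≥ (¬Any⇒All¬ xs none))) (<⇒≱ total)

sum-map-swap : {A B : Set} (xs : List A) (ys : List B) (f : A → B → ℕ) →
               sum (map (λ x → sum (map (f x) ys)) xs) ≡
               sum (map (λ y → sum (map (λ x → f x y) xs)) ys)
sum-map-swap xs []       f = sum-map-*ˡ 0 xs (λ _ → 0)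
sum-map-swap xs (y ∷ ys) f =
  trans (sum-map-+ xs (λ x → f x y) (λ x → sum (map (f x) ys)))
        (cong (sum (map (λ x → f x y) xs) +_) (sum-map-swap xs ys f))

indicator : Bool → ℕ
indicator true  = 1
indicator false = 0

module _ {A : Set} where

  count : (A → Bool) → List A → ℕ
  count p xs = sum (map (indicator ∘ p) xs)

  length-filter≡count : (p : A → Bool) (xs : List A) →
                        length (filter (T? ∘ p) xs) ≡ count p xs
  length-filter≡count p []       = refl
  length-filter≡count p (x ∷ xs) with p x
  ... | true  = cong suc (length-filter≡count p xs)
  ... | false = length-filter≡count p xs

  count-++ : (p : A → Bool) (xs ys : List A) →
             count p (xs ++ ys) ≡ count p xs + count p ys
  count-++ p xs ys = trans (cong sum (map-++ (indicator ∘ p) xs ys))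
                           (sum-++ (map (indicator ∘ p) xs) (map (indicator ∘ p) ys))

  count≤length : (p : A → Bool) (xs : List A) → count p xs ≤ length xs
  count≤length p []       = z≤n
  count≤length p (x ∷ xs) with p x
  ... | true  = s≤s (count≤length p xs)
  ... | false = m≤n⇒m≤1+n (count≤length p xs)

  length≤count⇒All : (p : A → Bool) (xs : List A) →
                     length xs ≤ count p xs → All (T ∘ p) xs
  length≤count⇒All p []       _     = All.[]
  length≤count⇒All p (x ∷ xs) full with p x in px
  ... | true  = subst T (≡-sym px) tt ∷ length≤count⇒All p xs (s≤s⁻¹ full)
  ... | false = contradiction full (<⇒≱ (s≤s (count≤length p xs)))

heavy-weight-split : ∀ {c k m} → c ≤ 4 → k ≤ m →
  (4 + (m + m)) * suc m < (2 + m) * (c + (k + k)) → m ≤ k × 3 ≤ c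
heavy-weight-split {c} {k} {m} c≤4 k≤m heavy = m≤k , 3≤c
  where
  open ≤-Reasoning
  heavy′ : 2 * suc m < c + (k + k)
  heavy′ = *-cancelˡ-< (2 + m) _ _ (subst (_< (2 + m) * (c + (k + k))) (halve m) heavy)
    where
    halve : ∀ m → (4 + (m + m)) * suc m ≡ (2 + m) * (2 * suc m)
    halve = solve-∀
  m≤k : m ≤ k
  m≤k = s≤s⁻¹ (s≤s⁻¹ (*-cancelˡ-< 2 (suc m) (suc (suc k)) (begin-strict
    2 * suc m    <⟨ heavy′ ⟩
    c + (k + k)  ≤⟨ +-monoˡ-≤ (k + k) c≤4 ⟩
    4 + (k + k)  ≡⟨ double k ⟩
    2 * suc (suc k) ∎)))
    where
    double : ∀ k → 4 + (k + k) ≡ 2 * suc (suc k)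
    double = solve-∀
  3≤c : 3 ≤ c
  3≤c = +-cancelʳ-≤ (m + m) 3 c (begin
    3 + (m + m)      ≡⟨ double m ⟩
    suc (2 * suc m)  ≤⟨ heavy′ ⟩
    c + (k + k)      ≤⟨ +-monoʳ-≤ c (+-mono-≤ k≤m k≤m) ⟩
    c + (m + m)      ∎)
    where
    double : ∀ m → 3 + (m + m) ≡ suc (2 * suc m)
    double = solve-∀

three-of-four : ∀ a b c d → 3 ≤ count id (a ∷ b ∷ c ∷ d ∷ []) →
                (T a × T c × (T b ⊎ T d)) ⊎ (T b × T d × (T a ⊎ T c))
three-of-four true  true  true  _     _ = inj₁ (tt , tt , inj₁ tt)
three-of-four true  false true  true  _ = inj₁ (tt , tt , inj₂ tt)
three-of-four true  true  false true  _ = inj₂ (tt , tt , inj₁ tt)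
three-of-four false true  true  true  _ = inj₂ (tt , tt , inj₂ tt)
three-of-four true  true  false false (s≤s (s≤s ()))
three-of-four true  false true  false (s≤s (s≤s ()))
three-of-four true  false false true  (s≤s (s≤s ()))
three-of-four false true  true  false (s≤s (s≤s ()))
three-of-four false true  false true  (s≤s (s≤s ()))
three-of-four false false true  true  (s≤s (s≤s ()))
three-of-four true  false false false (s≤s ())
three-of-four false true  false false (s≤s ())
three-of-four false false true  false (s≤s ())
three-of-four false false false true  (s≤s ())
three-of-four false false false false ()

module _ {n : ℕ} (G : Graph n) where

  Adj-sym : ∀ {u v} → Adj G u v → Adj G v u
  Adj-sym {u} {v} = subst T (Graph.sym G u v)

  Adj⇒≢ : ∀ {u v} → Adj G u v → u ≢ v
  Adj⇒≢ {u} u~u refl = subst T (irrefl G u) u~u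

  degree≡count : ∀ v → degree G v ≡ count (adj G v) (allFinL n)
  degree≡count v = length-filter≡count (adj G v) (allFinL n)

  sum-degree≡sum-count : (ws : List (Fin n)) →
    sum (map (degree G) ws) ≡ sum (map (λ x → count (λ v → adj G v x) ws) (allFinL n))
  sum-degree≡sum-count ws = trans (cong sum (map-cong degree≡count ws))
    (≡-sym (sum-map-swap (allFinL n) ws (λ x v → indicator (adj G v x))))

  HasCliqueIn-mono : ∀ {P Q : Fin n → Set} {k} → (∀ {x} → P x → Q x) →
                     HasCliqueIn G P k → HasCliqueIn G Q k
  HasCliqueIn-mono P⇒Q (f , f-inj , f∈P , f-clique) = f , f-inj , P⇒Q ∘ f∈P , f-clique

  HasCliqueIn-extend : ∀ {P : Fin n → Set} {k y} (K : HasCliqueIn G P k) → P y →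
                       (∀ i → Adj G y (proj₁ K i)) → HasCliqueIn G P (suc k)
  HasCliqueIn-extend {P} {y = y} (f , f-inj , f∈P , f-clique) y∈P y~f =
    y ◂ f , inj , member , clique
    where
    inj : ∀ {i j} → (y ◂ f) i ≡ (y ◂ f) j → i ≡ j
    inj {zero}  {zero}  _  = refl
    inj {zero}  {suc j} eq = contradiction eq (Adj⇒≢ (y~f j))
    inj {suc i} {zero}  eq = contradiction (≡-sym eq) (Adj⇒≢ (y~f i))
    inj {suc i} {suc j} eq = cong suc (f-inj eq)
    member : ∀ i → P ((y ◂ f) i)
    member zero    = y∈P
    member (suc i) = f∈P i
    clique : ∀ i j → i ≢ j → Adj G ((y ◂ f) i) ((y ◂ f) j)
    clique zero    zero    i≢j = contradiction refl i≢j
    clique zero    (suc j) _   = y~f j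
    clique (suc i) zero    _   = Adj-sym (y~f i)
    clique (suc i) (suc j) i≢j = f-clique i j (i≢j ∘ cong suc)

  Dense-from-clique : ∀ {p q u x m} (P : Fin n → Set) →
    (∀ {z} → P z → Adj G p z × Adj G q z × Adj G u z) →
    Adj G p u → Adj G q u → Adj G p x → Adj G q x → Adj G u x →
    (K : HasCliqueIn G P m) → (∀ i → Adj G x (proj₁ K i)) → Dense G (2 + m) p q
  Dense-from-clique {u = u} {x} P P⇒N p~u q~u p~x q~x u~x K@(f , _ , f∈P , _) x~f =
    HasCliqueIn-extend
      (HasCliqueIn-extend (HasCliqueIn-mono {P = P} (map₂ proj₁ ∘ P⇒N) K)
        (p~u , q~u) (proj₂ ∘ proj₂ ∘ P⇒N ∘ f∈P))
      (p~x , q~x) x~uf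
    where
    x~uf : ∀ i → Adj G x ((u ◂ f) i)
    x~uf zero    = Adj-sym u~x
    x~uf (suc i) = x~f i

  heavy-vertex : ∀ {b} → MinDegAbove G b → (ws : List (Fin n)) → .{{NonZero (length ws)}} →
                 ∃ λ x → length ws * (b ∸ 1) < b * count (λ v → adj G v x) ws
  heavy-vertex {b} δ ws = satisfied (pigeonhole (allFinL n) weight total)
    where
    weight : Fin n → ℕ
    weight x = b * count (λ v → adj G v x) ws
    total : length (allFinL n) * (length ws * (b ∸ 1)) < sum (map weight (allFinL n))
    total = begin-strict
      length (allFinL n) * (length ws * (b ∸ 1))
        ≡⟨ cong (_* (length ws * (b ∸ 1))) (length-tabulate {n = n} id) ⟩
      n * (length ws * (b ∸ 1))
        ≡⟨ trans (*-comm n _) (*-assoc (length ws) (b ∸ 1) n) ⟩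
      length ws * ((b ∸ 1) * n)        <⟨ m<n+m _ (>-nonZero⁻¹ (length ws)) ⟩
      length ws + length ws * ((b ∸ 1) * n) ≡⟨ ≡-sym (*-suc (length ws) _) ⟩
      length ws * suc ((b ∸ 1) * n)    ≤⟨ sum-map-≥ ws (λ v → b * degree G v) δ ⟩
      sum (map (λ v → b * degree G v) ws) ≡⟨ sum-map-*ˡ b ws (degree G) ⟩
      b * sum (map (degree G) ws)      ≡⟨ cong (b *_) (sum-degree≡sum-count ws) ⟩
      b * sum (map (λ x → count (λ v → adj G v x) ws) (allFinL n))
        ≡⟨ ≡-sym (sum-map-*ˡ b (allFinL n) _) ⟩
      sum (map weight (allFinL n))     ∎
      where open ≤-Reasoning

  common-neighbour-of-clique-and-three : ∀ {m} → MinDegAbove G (2 + m) → (cs : List (Fin n)) →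
    length cs ≡ 4 → (f : Fin m → Fin n) →
    ∃ λ x → (∀ i → Adj G x (f i)) × 3 ≤ count (λ v → adj G v x) cs
  common-neighbour-of-clique-and-three {m} δ cs@(_ ∷ _) |cs|≡4 f = x , x~f , proj₂ split
    where
    ks : List (Fin n)
    ks = tabulate f
    ws : List (Fin n)
    ws = cs ++ (ks ++ ks)
    -- matching cs against _ ∷ _ supplies the NonZero (length ws) instance
    heavy : ∃ λ x → length ws * suc m < (2 + m) * count (λ v → adj G v x) ws
    heavy = heavy-vertex δ ws
    x : Fin n
    x = proj₁ heavy
    x~ : Fin n → Bool
    x~ v = adj G v x
    |ks|≡m : length ks ≡ m
    |ks|≡m = length-tabulate f
    length-ws : length ws ≡ 4 + (m + m)
    length-ws = trans (length-++ cs) (cong₂ _+_ |cs|≡4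
                  (trans (length-++ ks) (cong₂ _+_ |ks|≡m |ks|≡m)))
    count-ws : count x~ ws ≡ count x~ cs + (count x~ ks + count x~ ks)
    count-ws = trans (count-++ x~ cs _) (cong (count x~ cs +_) (count-++ x~ ks ks))
    split : m ≤ count x~ ks × 3 ≤ count x~ cs
    split = heavy-weight-split (subst (count x~ cs ≤_) |cs|≡4 (count≤length x~ cs))
                         (subst (count x~ ks ≤_) |ks|≡m (count≤length x~ ks))
                         (subst₂ (λ l w → l * suc m < (2 + m) * w) length-ws count-ws (proj₂ heavy))
    x~f : ∀ i → Adj G x (f i)
    x~f i = Adj-sym (tabulate⁻ (length≤count⇒All x~ ks
                      (subst (_≤ count x~ ks) (≡-sym |ks|≡m) (proj₁ split))) i)

lemma4p4 : (b : ℕ) → 2 ≤ b → (n : ℕ) → (G : Graph n) → MinDegAbove G b →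
    (c₀ c₁ c₂ c₃ : Fin n) → InducedC4 G c₀ c₁ c₂ c₃ →
    HasCliqueIn G (CommonNbr4 G c₀ c₁ c₂ c₃) (b ∸ 2) →
    Dense G b c₀ c₂ ⊎ Dense G b c₁ c₃
lemma4p4 zero          ()
lemma4p4 (suc zero)    (s≤s ())
lemma4p4 (suc (suc m)) _ n G δ c₀ c₁ c₂ c₃
         (_ , _ , _ , _ , _ , _ , c₀~c₁ , c₁~c₂ , c₂~c₃ , c₃~c₀ , _ , _) K =
  dense-pair (three-of-four (adj G c₀ x) (adj G c₁ x) (adj G c₂ x) (adj G c₃ x) three)
  where
  cs : List (Fin n)
  cs = c₀ ∷ c₁ ∷ c₂ ∷ c₃ ∷ []
  C₄ : Fin n → Set
  C₄ = CommonNbr4 G c₀ c₁ c₂ c₃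
  heavy : ∃ λ x → (∀ i → Adj G x (proj₁ K i)) × 3 ≤ count (λ v → adj G v x) cs
  heavy = common-neighbour-of-clique-and-three G δ cs refl (proj₁ K)
  x : Fin n
  x = proj₁ heavy
  x~K : ∀ i → Adj G x (proj₁ K i)
  x~K = proj₁ (proj₂ heavy)
  three : 3 ≤ count (λ v → adj G v x) cs
  three = proj₂ (proj₂ heavy)
  dense-pair : (Adj G c₀ x × Adj G c₂ x × (Adj G c₁ x ⊎ Adj G c₃ x)) ⊎
               (Adj G c₁ x × Adj G c₃ x × (Adj G c₀ x ⊎ Adj G c₂ x)) →
               Dense G (2 + m) c₀ c₂ ⊎ Dense G (2 + m) c₁ c₃
  dense-pair (inj₁ (x~c₀ , x~c₂ , inj₁ x~c₁)) = inj₁ (Dense-from-clique G C₄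
    (λ (a₀ , a₁ , a₂ , _) → a₀ , a₂ , a₁) c₀~c₁ (Adj-sym G c₁~c₂) x~c₀ x~c₂ x~c₁ K x~K)
  dense-pair (inj₁ (x~c₀ , x~c₂ , inj₂ x~c₃)) = inj₁ (Dense-from-clique G C₄
    (λ (a₀ , _ , a₂ , a₃) → a₀ , a₂ , a₃) (Adj-sym G c₃~c₀) c₂~c₃ x~c₀ x~c₂ x~c₃ K x~K)
  dense-pair (inj₂ (x~c₁ , x~c₃ , inj₁ x~c₀)) = inj₂ (Dense-from-clique G C₄
    (λ (a₀ , a₁ , _ , a₃) → a₁ , a₃ , a₀) (Adj-sym G c₀~c₁) c₃~c₀ x~c₁ x~c₃ x~c₀ K x~K)
  dense-pair (inj₂ (x~c₁ , x~c₃ , inj₂ x~c₂)) = inj₂ (Dense-from-clique G C₄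
    (λ (_ , a₁ , a₂ , a₃) → a₁ , a₃ , a₂) c₁~c₂ (Adj-sym G c₂~c₃) x~c₁ x~c₃ x~c₂ K x~K)
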